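{- Let $d \geq 2$ be an integer and let $\mathcal{G}$ be a hereditary graph class with $d$-dominated balanced separators. Then, for every integer $\ell \geq 2$, every $K_{2,\ell}$-free graph $G\in\mathcal{G}$ with $n \geq 2$ vertices has a vertex $v$ such that $\alpha(G[N[v]]) \leq d\ell \log_2 n$.
   Context: Graphs are finite and simple. A graph class is hereditary if it is closed under taking induced subgraphs. A hereditary class $\mathcal{G}$ has $d$-dominated balanced separators if every graph $G\in\mathcal{G}$ contains a set $X\subseteq V(G)$ with $|X|\le d$ such that every connected component of $G-N[X]$ has at most $\frac12|V(G)|$ vertices, where $N[X]$ is the union of the closed neighborhoods of vertices of $X$. $K_{2,\ell}$ is the complete bipartite graph with parts of sizes $2$ and $\ell$; $K_{2,\ell}$-free means no induced subgraph isomorphic to $K_{2,\ell}$. $N[v]$ is the closed neighborhood of $v$ and $\alpha$ the independence number. -}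

module Defs where

open import Data.Nat using (ℕ; suc; _+_; _*_; _^_; _≤_)
open import Data.Fin using (Fin; _<_; toℕ)
open import Data.Bool using (Bool; true; false; _∧_; _∨_; not)
open import Data.List using (List; length)
open import Data.List.Membership.Propositional using (_∈_)
open import Data.List.Relation.Unary.All using (All)
open import Data.List.Relation.Unary.Unique.Propositional using (Unique)
open import Data.Product using (Σ; ∃; _×_; _,_)
open import Data.Sum using (_⊎_)
open import Relation.Binary.PropositionalEquality using (_≡_)
open import Relation.Nullary using (¬_)
open import Function.Definitions using (Injective)

record Graph : Set where
  field
    size  : ℕ
    adj   : Fin size → Fin size → Bool
    sym   : ∀ u v → adj u v ≡ adj v u
    irrefl : ∀ v → adj v v ≡ false

open Graph public

V : Graph → Set
V G = Fin (size G)

Adj : (G : Graph) → V G → V G → Set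
Adj G u v = adj G u v ≡ true

_≼_ : Graph → Graph → Set
H ≼ G = Σ (V H → V G) λ f →
          Injective _≡_ _≡_ f × (∀ u v → adj G (f u) (f v) ≡ adj H u v)

GraphClass : Set₁
GraphClass = Graph → Set

Hereditary : GraphClass → Set
Hereditary 𝒢 = ∀ G H → H ≼ G → 𝒢 G → 𝒢 H

InClosedNbhd : (G : Graph) → List (V G) → V G → Set
InClosedNbhd G X v = ∃ λ x → x ∈ X × (x ≡ v ⊎ Adj G x v)

data Reach (G : Graph) (X : List (V G)) (u : V G) : V G → Set where
  here : ¬ InClosedNbhd G X u → Reach G X u u
  step : ∀ {w v} → Reach G X u w → Adj G w v → ¬ InClosedNbhd G X v →
         Reach G X u v

-- Every connected component of G − N[X] has at most |V(G)|/2 vertices: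
-- for each vertex u of G − N[X], any duplicate-free list of vertices of
-- the component of u has length L with 2·L ≤ |V(G)|.
BalancedSeparator : (G : Graph) → List (V G) → Set
BalancedSeparator G X =
  ∀ (u : V G) (C : List (V G)) → Unique C → All (Reach G X u) C →
  2 * length C ≤ size G

HasDominatedBalancedSeparators : ℕ → GraphClass → Set
HasDominatedBalancedSeparators d 𝒢 =
  ∀ G → 𝒢 G → ∃ λ (X : List (V G)) → length X ≤ d × BalancedSeparator G X

-- The complete bipartite graph K_{2,ℓ} on Fin (2 + ℓ):
-- vertices 0,1 form one side, the others the other side.
side : ∀ {ℓ} → Fin (2 + ℓ) → Bool
side i with toℕ i
... | 0 = true
... | 1 = true
... | _ = false

xorB : Bool → Bool → Bool
xorB true  b = not b
xorB false b = b

K2 : ℕ → Graph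
K2 ℓ = record
  { size = 2 + ℓ
  ; adj = λ i j → xorB (side i) (side j)
  ; sym = λ i j → lemma (side i) (side j)
  ; irrefl = λ i → lemma₂ (side i)
  }
  where
  lemma : ∀ a b → xorB a b ≡ xorB b a
  lemma true true = _≡_.refl
  lemma true false = _≡_.refl
  lemma false true = _≡_.refl
  lemma false false = _≡_.refl
  lemma₂ : ∀ a → xorB a a ≡ false
  lemma₂ true = _≡_.refl
  lemma₂ false = _≡_.refl

K2ℓFree : ℕ → Graph → Set
K2ℓFree ℓ G = ¬ (K2 ℓ ≼ G)

InClosedNbhdOf : (G : Graph) → V G → V G → Set
InClosedNbhdOf G v w = v ≡ w ⊎ Adj G v w

IndependentIn : (G : Graph) → List (V G) → Set
IndependentIn G S = ∀ {x y} → x ∈ S → y ∈ S → adj G x y ≡ false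

-- α(G[N[v]]) ≤ d·ℓ·log₂ n, stated exactly as: every independent set S of
-- G[N[v]] satisfies 2^|S| ≤ n^(d·ℓ).
AlphaNbhdBound : (G : Graph) → V G → ℕ → ℕ → Set
AlphaNbhdBound G v d ℓ =
  ∀ (S : List (V G)) → Unique S → All (InClosedNbhdOf G v) S → IndependentIn G S →
  2 ^ length S ≤ size G ^ (d * ℓ)

{-# OPTIONS --safe #-}
module Submission where

-- By strong induction on a set L of vertices we find v ∈ L with
-- 2^α(G[L ∩ N[v]]) ≤ 2·|L|^(d(ℓ−1)), which for L = V(G) and n ≥ 2 is at most n^(dℓ).
-- Take a balanced separator X of G[L] with |X| ≤ d. If G[L] − N[X] is nonempty, recurse on one
-- of its components W, which has at most |L|/2 vertices: a neighbour of v ∈ W outside W lies in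
-- N(x) for some x ∈ X not in N[v], and as G is K_{2,ℓ}-free an independent set contains at most
-- ℓ − 1 common neighbours of v and x. Otherwise N[X] ⊇ L, so some x ∈ X has |N[x] ∩ L| ≥ |L|/d.
-- If N[x] ⊇ L, then x lies in no independent set of size ≥ 2 and we recurse on L − x; otherwise
-- we recurse on L ∖ N[x], whose at most (1 − 1/d)|L| vertices pay for the ℓ − 1 extra ones in
-- N(x), because (1 − 1/d)^d ≤ 1/2.

open import Defs hiding (sym)

open import Data.Nat
open import Data.Nat.Properties
open import Data.Nat.Induction using (<-wellFounded)
open import Data.Nat.Tactic.RingSolver using (solve-∀)
open import Data.Fin as Fin using (Fin; zero; suc; inject≤)
open import Data.Fin.Properties using (inject≤-injective; any?)
import Data.Bool as Bool
open import Data.Bool using (true; false)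
open import Data.Bool.Properties using (¬-not; not-¬)
open import Data.List using (List; []; _∷_; length; map; filter; lookup; allFin)
open import Data.List.Properties using (length-map; length-tabulate; filter-all; filter-notAll)
open import Data.List.Relation.Unary.All as All using (All; []; _∷_)
open import Data.List.Relation.Unary.All.Properties using (¬Any⇒All¬; ¬All⇒Any¬; map⁺)
open import Data.List.Relation.Unary.Any as Any using (Any; here; there)
open import Data.List.Relation.Unary.Any.Properties using (lookup-index)
open import Data.List.Relation.Unary.AllPairs using ([]; _∷_)
open import Data.List.Relation.Unary.Unique.Propositional using (Unique)
import Data.List.Relation.Unary.Unique.Propositional.Properties as Unique
open import Data.List.Membership.Propositional using (_∈_; _∉_; find; lose)
open import Data.List.Membership.Propositional.Properties
  using (∈-filter⁺; ∈-filter⁻; ∈-lookup; ∈-allFin; ∈-map⁺; ∈-map⁻; ∈-length)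
open import Data.List.Relation.Binary.Sublist.Propositional.Properties using (filter-⊆; filter⁺)
open import Data.List.Relation.Binary.Sublist.Heterogeneous.Properties using (length-mono-≤)
open import Data.Product using (∃; _×_; _,_; proj₁; proj₂)
open import Data.Sum as Sum using (_⊎_; inj₁; inj₂; [_,_]′)
open import Data.Empty using (⊥-elim)
open import Function using (_∘_; id)
open import Function.Definitions using (Injective)
open import Induction.WellFounded as WF using ()
open import Level using (0ℓ)
open import Relation.Nullary using (¬_; yes; no)
open import Relation.Nullary.Decidable as Dec using (¬?; _×-dec_; _⊎-dec_; decidable-stable)
open import Relation.Unary using (Pred; Decidable)
open import Relation.Unary.Properties using (∁?)
open import Relation.Binary.Definitions using (DecidableEquality)
open import Relation.Binary.Construct.On using (wellFounded)
open import Relation.Binary.PropositionalEquality using (_≡_; _≢_; refl; cong; sym; trans; subst; module ≡-Reasoning)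

^-distribʳ-* : ∀ m n p → (m * n) ^ p ≡ m ^ p * n ^ p
^-distribʳ-* m n zero    = refl
^-distribʳ-* m n (suc p) = begin
  m * n * (m * n) ^ p       ≡⟨ cong (m * n *_) (^-distribʳ-* m n p) ⟩
  m * n * (m ^ p * n ^ p)   ≡⟨ shuffle m n (m ^ p) (n ^ p) ⟩
  m * m ^ p * (n * n ^ p)   ∎
  where
  open ≡-Reasoning
  shuffle : ∀ a b c e → a * b * (c * e) ≡ a * c * (b * e)
  shuffle = solve-∀

-- (1 + 1/a)^k ≥ 1 + k/a, cleared of denominators.
bernoulli : ∀ a k → a ^ k * (a + k) ≤ suc a ^ k * a
bernoulli a zero    = ≤-reflexive (+-identityʳ (a + 0))
bernoulli a (suc k) = begin
  a * a ^ k * (a + suc k)              ≡⟨ expand a (a ^ k) k ⟩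
  a * (a ^ k * (a + k)) + a * a ^ k    ≤⟨ +-mono-≤ (*-monoʳ-≤ a (bernoulli a k))
                                                   (*-monoʳ-≤ a (^-monoˡ-≤ k (n≤1+n a))) ⟩
  a * (suc a ^ k * a) + a * suc a ^ k  ≡⟨ collect a (suc a ^ k) ⟩
  suc a * suc a ^ k * a                ∎
  where
  open ≤-Reasoning
  expand : ∀ a p k → a * p * (a + suc k) ≡ a * (p * (a + k)) + a * p
  expand = solve-∀
  collect : ∀ a q → a * (q * a) + a * q ≡ (suc a) * q * a
  collect = solve-∀

2*a^[1+a]≤[1+a]^[1+a] : ∀ a .{{_ : NonZero a}} → 2 * a ^ suc a ≤ suc a ^ suc a
2*a^[1+a]≤[1+a]^[1+a] a = *-cancelʳ-≤ _ _ a (begin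
  2 * a ^ suc a * a                ≤⟨ m≤m+n _ _ ⟩
  2 * a ^ suc a * a + a ^ suc a    ≡⟨ regroup a (a ^ suc a) ⟩
  a ^ suc a * (a + suc a)          ≤⟨ bernoulli a (suc a) ⟩
  suc a ^ suc a * a                ∎)
  where
  open ≤-Reasoning
  regroup : ∀ a p → 2 * p * a + p ≡ p * (a + suc a)
  regroup = solve-∀

-- (1 − 1/d)^d ≤ 1/2 for d ≥ 2: the hypothesis says m ≤ (1 − 1/d) n.
pow-shrink : ∀ d m n → 2 ≤ d → d * m + n ≤ d * n → 2 * m ^ d ≤ n ^ d
pow-shrink 1 m n (s≤s ())
pow-shrink (suc a@(suc _)) m n _ dm+n≤dn = *-cancelˡ-≤ (a ^ suc a) {{m^n≢0 a (suc a)}} (begin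
  a ^ d * (2 * m ^ d)   ≡⟨ regroup (a ^ d) (m ^ d) ⟩
  2 * a ^ d * m ^ d     ≤⟨ *-monoˡ-≤ (m ^ d) (2*a^[1+a]≤[1+a]^[1+a] a) ⟩
  d ^ d * m ^ d         ≡⟨ ^-distribʳ-* d m d ⟨
  (d * m) ^ d           ≤⟨ ^-monoˡ-≤ d dm≤an ⟩
  (a * n) ^ d           ≡⟨ ^-distribʳ-* a n d ⟩
  a ^ d * n ^ d         ∎)
  where
  open ≤-Reasoning
  d = suc a
  dm≤an : d * m ≤ a * n
  dm≤an = +-cancelʳ-≤ n (d * m) (a * n) (≤-trans dm+n≤dn (≤-reflexive (+-comm n (a * n))))
  regroup : ∀ p q → p * (2 * q) ≡ 2 * p * q
  regroup = solve-∀

pow-scale : ∀ c m n d l → c * m ^ d ≤ n ^ d → m ^ (d * l) * c ^ l ≤ n ^ (d * l)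
pow-scale c m n d l cmᵈ≤nᵈ = begin
  m ^ (d * l) * c ^ l   ≡⟨ cong (_* c ^ l) (^-*-assoc m d l) ⟨
  (m ^ d) ^ l * c ^ l   ≡⟨ ^-distribʳ-* (m ^ d) c l ⟨
  (m ^ d * c) ^ l       ≤⟨ ^-monoˡ-≤ l (≤-trans (≤-reflexive (*-comm (m ^ d) c)) cmᵈ≤nᵈ) ⟩
  (n ^ d) ^ l           ≡⟨ ^-*-assoc n d l ⟩
  n ^ (d * l)           ∎
  where open ≤-Reasoning

2*m≤n⇒m<n : ∀ {m n} → 1 ≤ m → 2 * m ≤ n → m < n
2*m≤n⇒m<n {m} 1≤m 2m≤n = ≤-trans (m<m+n m 1≤m) (≤-trans (≤-reflexive (cong (m +_) (sym (+-identityʳ m)))) 2m≤n)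

2*n^[d*l]≤n^[d*[1+l]] : ∀ d l n → 1 ≤ d → 2 ≤ n → 2 * n ^ (d * l) ≤ n ^ (d * suc l)
2*n^[d*l]≤n^[d*[1+l]] d l n 1≤d 2≤n = begin
  2 * n ^ (d * l)       ≤⟨ *-monoˡ-≤ (n ^ (d * l)) (≤-trans 2≤n n≤nᵈ) ⟩
  n ^ d * n ^ (d * l)   ≡⟨ ^-distribˡ-+-* n d (d * l) ⟨
  n ^ (d + d * l)       ≡⟨ cong (n ^_) (*-suc d l) ⟨
  n ^ (d * suc l)       ∎
  where
  open ≤-Reasoning
  instance _ = >-nonZero (≤-trans (s≤s z≤n) 2≤n)
  n≤nᵈ : n ≤ n ^ d
  n≤nᵈ = ≤-trans (≤-reflexive (sym (*-identityʳ n))) (^-monoʳ-≤ n 1≤d)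

module _ {A : Set} {P : Pred A 0ℓ} (P? : Decidable P) where

  length-filter-∁ : ∀ xs → length (filter P? xs) + length (filter (∁? P?) xs) ≡ length xs
  length-filter-∁ []       = refl
  length-filter-∁ (x ∷ xs) with P? x
  ... | yes _ = cong suc (length-filter-∁ xs)
  ... | no  _ = trans (+-suc _ _) (cong suc (length-filter-∁ xs))

  length-filter-mono : ∀ {Q : Pred A 0ℓ} (Q? : Decidable Q) xs →
                       length (filter P? (filter Q? xs)) ≤ length (filter P? xs)
  length-filter-mono Q? xs = length-mono-≤ (filter⁺ P? P? (λ { refl p → p }) (filter-⊆ Q? xs))

module _ {A : Set} where

  Unique⇒lookup-injective : ∀ {xs : List A} → Unique xs → ∀ {i j} → lookup xs i ≡ lookup xs j → i ≡ j
  Unique⇒lookup-injective (_     ∷ _)  {zero}  {zero}  _  = refl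
  Unique⇒lookup-injective (x∉xs ∷ _)  {zero}  {suc j} eq = ⊥-elim (All.lookup x∉xs (∈-lookup j) eq)
  Unique⇒lookup-injective (x∉xs ∷ _)  {suc i} {zero}  eq = ⊥-elim (All.lookup x∉xs (∈-lookup i) (sym eq))
  Unique⇒lookup-injective (_     ∷ u) {suc i} {suc j} eq = cong suc (Unique⇒lookup-injective u eq)

  Unique-⊆⇒length≤ : DecidableEquality A → ∀ {xs ys : List A} → Unique xs → All (_∈ ys) xs → length xs ≤ length ys
  Unique-⊆⇒length≤ _≟_ {[]}     _            _            = z≤n
  Unique-⊆⇒length≤ _≟_ {x ∷ xs} {ys} (x∉xs ∷ u) (x∈ys ∷ xs⊆ys) = begin-strict
    length xs                 ≤⟨ Unique-⊆⇒length≤ _≟_ u xs⊆ys-x ⟩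
    length (filter ≢x? ys)    <⟨ filter-notAll ≢x? ys (Any.map (λ x≡y x≢y → x≢y x≡y) x∈ys) ⟩
    length ys                 ∎
    where
    open ≤-Reasoning
    ≢x? = ∁? (x ≟_)
    xs⊆ys-x : All (_∈ filter ≢x? ys) xs
    xs⊆ys-x = All.zipWith (λ (x≢y , y∈ys) → ∈-filter⁺ ≢x? y∈ys x≢y) (x∉xs , xs⊆ys)

module _ {A B : Set} {P : A → Pred B 0ℓ} (P? : ∀ a → Decidable (P a)) where

  Covers : List A → List B → Set
  Covers X = All (λ b → Any (λ a → P a b) X)

  private
    heaviest : ∀ a X L → Covers (a ∷ X) L →
               ∃ λ x → x ∈ a ∷ X × length L ≤ length (a ∷ X) * length (filter (P? x) L)
    heaviest a [] L cov = a , here refl , ≤-reflexive (begin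
      length L                          ≡⟨ cong length (filter-all (P? a) (All.map (λ { (here p) → p }) cov)) ⟨
      length (filter (P? a) L)          ≡⟨ *-identityˡ _ ⟨
      1 * length (filter (P? a) L)      ∎)
      where open ≡-Reasoning
    heaviest a (a′ ∷ X) L cov = larger (heaviest a′ X L′ (All.tabulate covers-rest))
      where
      L′ = filter (∁? (P? a)) L
      k = length (a′ ∷ X)

      count : A → ℕ
      count y = length (filter (P? y) L)

      covers-rest : ∀ {b} → b ∈ L′ → Any (λ x → P x b) (a′ ∷ X)
      covers-rest b∈L′ with ∈-filter⁻ (∁? (P? a)) b∈L′
      ... | b∈L , ¬Pab with All.lookup cov b∈L
      ... | here Pab = ⊥-elim (¬Pab Pab)
      ... | there p  = p

      split : ∀ x → length L′ ≤ k * length (filter (P? x) L′) → length L ≤ count a + k * count x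
      split x L′≤ = begin
        length L                                      ≡⟨ length-filter-∁ (P? a) L ⟨
        count a + length L′                           ≤⟨ +-monoʳ-≤ (count a) L′≤ ⟩
        count a + k * length (filter (P? x) L′)       ≤⟨ +-monoʳ-≤ (count a) (*-monoʳ-≤ k (length-filter-mono (P? x) (∁? (P? a)) L)) ⟩
        count a + k * count x                         ∎
        where open ≤-Reasoning

      larger : (∃ λ x → x ∈ a′ ∷ X × length L′ ≤ k * length (filter (P? x) L′)) →
               ∃ λ x → x ∈ a ∷ a′ ∷ X × length L ≤ suc k * count x
      larger (x , x∈ , L′≤) with ≤-total (count a) (count x)
      ... | inj₁ a≤x = x , there x∈ , ≤-trans (split x L′≤) (+-monoˡ-≤ (k * count x) a≤x)
      ... | inj₂ x≤a = a , here refl , ≤-trans (split x L′≤) (+-monoʳ-≤ (count a) (*-monoʳ-≤ k x≤a))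

  heaviest-cover : ∀ X L → Covers X L → 1 ≤ length L →
                   ∃ λ x → x ∈ X × length L ≤ length X * length (filter (P? x) L)
  heaviest-cover []      []      _        ()
  heaviest-cover []      (_ ∷ _) (() ∷ _) _
  heaviest-cover (a ∷ X) L       cov      _ = heaviest a X L cov

InClosedNbhdOf? : (G : Graph) (x : V G) → Decidable (InClosedNbhdOf G x)
InClosedNbhdOf? G x u = (x Fin.≟ u) ⊎-dec (adj G x u Bool.≟ true)

InClosedNbhd? : (G : Graph) (X : List (V G)) → Decidable (InClosedNbhd G X)
InClosedNbhd? G X v = Dec.map′ find (λ (_ , x∈X , p) → lose x∈X p) (Any.any? (λ x → InClosedNbhdOf? G x v) X)

Reach⇒∉N[X] : ∀ {G X u w} → Reach G X u w → ¬ InClosedNbhd G X w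
Reach⇒∉N[X] (here w∉)     = w∉
Reach⇒∉N[X] (step _ _ w∉) = w∉

Unique⇒length≤size : (G : Graph) {W : List (V G)} → Unique W → length W ≤ size G
Unique⇒length≤size G uW = ≤-trans (Unique-⊆⇒length≤ Fin._≟_ uW (All.tabulate (λ _ → ∈-allFin _)))
                                   (≤-reflexive (length-tabulate id))

module _ (H : Graph) (X : List (V H)) where

  open import Data.List.Membership.DecPropositional (Fin._≟_ {size H}) using (_∈?_)

  ClosedOutside : List (V H) → Set
  ClosedOutside W = ∀ {w w′} → w ∈ W → Adj H w w′ → w′ ∈ W ⊎ InClosedNbhd H X w′

  component : ∀ u → ¬ InClosedNbhd H X u →
              ∃ λ W → Unique W × u ∈ W × All (Reach H X u) W × ClosedOutside W
  component u u∉ = grow (size H) (u ∷ []) (m≤m+n (size H) 1) ([] ∷ []) (here refl) (here u∉ ∷ [])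
    where
    ExitsAt : List (V H) → V H → Set
    ExitsAt W w = ∃ λ w′ → Adj H w w′ × ¬ InClosedNbhd H X w′ × w′ ∉ W

    ExitsAt? : ∀ W → Decidable (ExitsAt W)
    ExitsAt? W w = any? (λ w′ → (adj H w w′ Bool.≟ true) ×-dec ¬? (InClosedNbhd? H X w′) ×-dec ¬? (w′ ∈? W))

    grow : ∀ fuel W → size H ≤ fuel + length W → Unique W → u ∈ W → All (Reach H X u) W →
           ∃ λ W → Unique W × u ∈ W × All (Reach H X u) W × ClosedOutside W
    grow fuel W size≤ uW u∈W reachW with Any.any? (ExitsAt? W) W
    ... | no noExit = W , uW , u∈W , reachW , closed
      where
      closed : ClosedOutside W
      closed {w} {w′} w∈W w~w′ with InClosedNbhd? H X w′ | w′ ∈? W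
      ... | yes w′∈N | _       = inj₂ w′∈N
      ... | no _     | yes w′∈W = inj₁ w′∈W
      ... | no w′∉N  | no w′∉W  = ⊥-elim (noExit (lose w∈W (w′ , w~w′ , w′∉N , w′∉W)))
    ... | yes exit with find exit
    ... | w , w∈W , w′ , w~w′ , w′∉N , w′∉W with fuel
    ...   | zero     = ⊥-elim (<⇒≱ (Unique⇒length≤size H (¬Any⇒All¬ W w′∉W ∷ uW)) size≤)
    ...   | suc fuel = grow fuel (w′ ∷ W) (≤-trans size≤ (≤-reflexive (sym (+-suc fuel (length W)))))
                         (¬Any⇒All¬ W w′∉W ∷ uW) (there u∈W) (step (All.lookup reachW w∈W) w~w′ w′∉N ∷ reachW)

induced : (G : Graph) → List (V G) → Graph
induced G L = record
  { size   = length L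
  ; adj    = λ i j → adj G (lookup L i) (lookup L j)
  ; sym    = λ i j → Graph.sym G (lookup L i) (lookup L j)
  ; irrefl = λ i → irrefl G (lookup L i)
  }

induced-≼ : (G : Graph) {L : List (V G)} → Unique L → induced G L ≼ G
induced-≼ G {L} uL = lookup L , Unique⇒lookup-injective uL , λ _ _ → refl

module _ (G : Graph) (L : List (V G)) {X : List (Fin (length L))} where

  N[X]-induced⁺ : ∀ {i} → InClosedNbhd (induced G L) X i → InClosedNbhd G (map (lookup L) X) (lookup L i)
  N[X]-induced⁺ (x , x∈X , x~i) = lookup L x , ∈-map⁺ (lookup L) x∈X , Sum.map₁ (cong (lookup L)) x~i

  N[X]-induced⁻ : Unique L → ∀ {i} → InClosedNbhd G (map (lookup L) X) (lookup L i) → InClosedNbhd (induced G L) X i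
  N[X]-induced⁻ uL (y , y∈ , y~i) with ∈-map⁻ (lookup L) y∈
  ... | x , x∈X , refl = x , x∈X , Sum.map₁ (Unique⇒lookup-injective uL) y~i

  map-lookup-⊆ : ∀ {x} → x ∈ map (lookup L) X → x ∈ L
  map-lookup-⊆ x∈ with ∈-map⁻ (lookup L) x∈
  ... | i , _ , refl = ∈-lookup i

  N[X]-induced-cover : (∀ i → InClosedNbhd (induced G L) X i) →
                       All (λ s → Any (λ x → InClosedNbhdOf G x s) (map (lookup L) X)) L
  N[X]-induced-cover all-dominated = All.tabulate λ s∈L → cover (lookup-index s∈L)
    where
    cover : ∀ {s i} → s ≡ lookup L i → Any (λ x → InClosedNbhdOf G x s) (map (lookup L) X)
    cover {i = i} refl = let (_ , x∈ , x~s) = N[X]-induced⁺ (all-dominated i) in lose x∈ x~s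

record SmallComponent (G : Graph) (L X : List (V G)) : Set where
  field
    part     : List (V G)
    unique   : Unique part
    nonempty : 1 ≤ length part
    small    : 2 * length part ≤ length L
    ⊆L       : All (_∈ L) part
    avoids   : All (λ w → ¬ InClosedNbhd G X w) part
    closed   : ∀ {w s} → w ∈ part → s ∈ L → Adj G w s → s ∈ part ⊎ InClosedNbhd G X s

small-component : (G : Graph) {L : List (V G)} {X : List (Fin (length L))} → Unique L →
                 BalancedSeparator (induced G L) X → ∀ u → ¬ InClosedNbhd (induced G L) X u →
                 SmallComponent G L (map (lookup L) X)
small-component G {L} {X} uL balanced u u∉ with component (induced G L) X u u∉
... | W , uW , u∈W , reachW , closedW = record
  { part     = map (lookup L) W
  ; unique   = Unique.map⁺ (Unique⇒lookup-injective uL) uW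
  ; nonempty = ∈-length (∈-map⁺ (lookup L) u∈W)
  ; small    = subst (λ n → 2 * n ≤ length L) (sym (length-map (lookup L) W)) (balanced u W uW reachW)
  ; ⊆L       = map⁺ (All.tabulate (λ {i} _ → ∈-lookup i))
  ; avoids   = map⁺ (All.map (λ reach → Reach⇒∉N[X] reach ∘ N[X]-induced⁻ G L uL) reachW)
  ; closed   = closed
  }
  where
  closed′ : ∀ {i j s} → i ∈ W → s ≡ lookup L j → Adj G (lookup L i) s →
            s ∈ map (lookup L) W ⊎ InClosedNbhd G (map (lookup L) X) s
  closed′ i∈W refl i~j = Sum.map (∈-map⁺ (lookup L)) (N[X]-induced⁺ G L) (closedW i∈W i~j)

  closed : ∀ {w s} → w ∈ map (lookup L) W → s ∈ L → Adj G w s →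
           s ∈ map (lookup L) W ⊎ InClosedNbhd G (map (lookup L) X) s
  closed w∈ s∈L w~s with ∈-map⁻ (lookup L) w∈
  ... | i , i∈W , refl = closed′ i∈W (lookup-index s∈L) w~s

IndependentIn-filter : (G : Graph) {S : List (V G)} {P : V G → Set} (P? : Decidable P) →
                       IndependentIn G S → IndependentIn G (filter P? S)
IndependentIn-filter G P? ind x∈ y∈ = ind (proj₁ (∈-filter⁻ P? x∈)) (proj₁ (∈-filter⁻ P? y∈))

IndepNbhdBound : (G : Graph) → List (V G) → V G → ℕ → Set
IndepNbhdBound G L v B =
  ∀ S → Unique S → All (λ s → s ∈ L × InClosedNbhdOf G v s) S → IndependentIn G S → 2 ^ length S ≤ B

module _ (G : Graph) where

  open import Data.List.Membership.DecPropositional (Fin._≟_ {size G}) using (_∈?_)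

  IndepNbhdBound-mono : ∀ {L v B B′} → B ≤ B′ → IndepNbhdBound G L v B → IndepNbhdBound G L v B′
  IndepNbhdBound-mono B≤B′ bound S uS S⊆ ind = ≤-trans (bound S uS S⊆ ind) B≤B′

  IndepNbhdBound-[] : ∀ {v} → IndepNbhdBound G [] v 1
  IndepNbhdBound-[] []      _ _              _ = ≤-refl
  IndepNbhdBound-[] (_ ∷ _) _ ((() , _) ∷ _) _

  IndepNbhdBound-universal : ∀ {L x v B} → All (InClosedNbhdOf G x) L → 2 ≤ B →
                             IndepNbhdBound G (filter (∁? (x Fin.≟_)) L) v B → IndepNbhdBound G L v B
  IndepNbhdBound-universal {L} {x} {v} universal 2≤B bound S uS S⊆ ind with x ∈? S
  ... | yes x∈S = ≤-trans (^-monoʳ-≤ 2 (Unique-⊆⇒length≤ Fin._≟_ {ys = x ∷ []} uS (All.tabulate (here ∘ only-x)))) 2≤B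
    where
    only-x : ∀ {s} → s ∈ S → s ≡ x
    only-x s∈S with All.lookup universal (proj₁ (All.lookup S⊆ s∈S))
    ... | inj₁ x≡s = sym x≡s
    ... | inj₂ x~s = ⊥-elim (not-¬ x~s (ind x∈S s∈S))
  ... | no x∉S = bound S uS (All.tabulate S⊆L-x) ind
    where
    S⊆L-x : ∀ {s} → s ∈ S → s ∈ filter (∁? (x Fin.≟_)) L × InClosedNbhdOf G v s
    S⊆L-x s∈S with All.lookup S⊆ s∈S
    ... | s∈L , v~s = ∈-filter⁺ (∁? (x Fin.≟_)) s∈L (λ { refl → x∉S s∈S }) , v~s

module _ (G : Graph) {ℓ : ℕ} where

  K2-≼ : (x v : V G) (t : Fin ℓ → V G) → x ≢ v → adj G x v ≡ false → Injective _≡_ _≡_ t →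
         (∀ i j → adj G (t i) (t j) ≡ false) → (∀ i → Adj G x (t i) × Adj G v (t i)) → K2 ℓ ≼ G
  K2-≼ x v t x≢v x≁v t-inj t-indep t-common = f , f-inj , f-adj
    where
    x≢t : ∀ i → x ≢ t i
    x≢t i refl = not-¬ (proj₁ (t-common i)) (irrefl G x)
    v≢t : ∀ i → v ≢ t i
    v≢t i refl = not-¬ (proj₂ (t-common i)) (irrefl G v)

    f : Fin (2 + ℓ) → V G
    f zero          = x
    f (suc zero)    = v
    f (suc (suc i)) = t i

    f-inj : Injective _≡_ _≡_ f
    f-inj {zero}          {zero}          _  = refl
    f-inj {zero}          {suc zero}      eq = ⊥-elim (x≢v eq)
    f-inj {zero}          {suc (suc j)}   eq = ⊥-elim (x≢t j eq)
    f-inj {suc zero}      {zero}          eq = ⊥-elim (x≢v (sym eq))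
    f-inj {suc zero}      {suc zero}      _  = refl
    f-inj {suc zero}      {suc (suc j)}   eq = ⊥-elim (v≢t j eq)
    f-inj {suc (suc i)}   {zero}          eq = ⊥-elim (x≢t i (sym eq))
    f-inj {suc (suc i)}   {suc zero}      eq = ⊥-elim (v≢t i (sym eq))
    f-inj {suc (suc i)}   {suc (suc j)}   eq = cong (Fin.suc ∘ Fin.suc) (t-inj eq)

    f-adj : ∀ a b → adj G (f a) (f b) ≡ adj (K2 ℓ) a b
    f-adj zero          zero          = irrefl G x
    f-adj zero          (suc zero)    = x≁v
    f-adj zero          (suc (suc j)) = proj₁ (t-common j)
    f-adj (suc zero)    zero          = trans (Graph.sym G v x) x≁v
    f-adj (suc zero)    (suc zero)    = irrefl G v
    f-adj (suc zero)    (suc (suc j)) = proj₂ (t-common j)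
    f-adj (suc (suc i)) zero          = trans (Graph.sym G (t i) x) (proj₁ (t-common i))
    f-adj (suc (suc i)) (suc zero)    = trans (Graph.sym G (t i) v) (proj₂ (t-common i))
    f-adj (suc (suc i)) (suc (suc j)) = t-indep i j

module _ (G : Graph) {l : ℕ} (free : K2ℓFree (suc l) G) where

  common-neighbours-≤ : ∀ {x v T} → x ≢ v → adj G x v ≡ false → Unique T → IndependentIn G T →
                        All (λ t → Adj G x t × Adj G v t) T → length T ≤ l
  common-neighbours-≤ {x} {v} {T} x≢v x≁v uT ind common = ≤-pred (≰⇒> λ ℓ≤|T| →
    free (K2-≼ G x v (lookup T ∘ (λ i → inject≤ i ℓ≤|T|)) x≢v x≁v
           (λ {i} {j} eq → inject≤-injective ℓ≤|T| ℓ≤|T| i j (Unique⇒lookup-injective uT eq))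
           (λ i j → ind (∈-lookup _) (∈-lookup _))
           (λ i → All.lookup common (∈-lookup _))))

  common-neighbours-of-list-≤ : ∀ Y {v T} → ¬ InClosedNbhd G Y v → Unique T → IndependentIn G T →
                                All (λ t → Adj G v t × ∃ λ y → y ∈ Y × Adj G y t) T → length T ≤ length Y * l
  common-neighbours-of-list-≤ []      {T = []}    _ _ _ _                       = z≤n
  common-neighbours-of-list-≤ []      {T = _ ∷ _} _ _ _ ((_ , _ , () , _) ∷ _)
  common-neighbours-of-list-≤ (y ∷ Y) {v} {T} v∉N[yY] uT ind common = begin
    length T                                         ≡⟨ length-filter-∁ y~? T ⟨
    length (filter y~? T) + length (filter (∁? y~?) T) ≤⟨ +-mono-≤ via-y≤ via-Y≤ ⟩
    l + length Y * l                                 ∎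
    where
    open ≤-Reasoning
    y~? : Decidable (Adj G y)
    y~? t = adj G y t Bool.≟ true

    via-y : ∀ {t} → t ∈ filter y~? T → Adj G y t × Adj G v t
    via-y t∈ with ∈-filter⁻ y~? t∈
    ... | t∈T , y~t = y~t , proj₁ (All.lookup common t∈T)

    via-Y : ∀ {t} → t ∈ filter (∁? y~?) T → Adj G v t × ∃ λ z → z ∈ Y × Adj G z t
    via-Y t∈ with ∈-filter⁻ (∁? y~?) t∈
    ... | t∈T , y≁t with All.lookup common t∈T
    ... | _   , _ , here refl , y~t  = ⊥-elim (y≁t y~t)
    ... | v~t , z , there z∈Y , z~t = v~t , z , z∈Y , z~t

    via-y≤ : length (filter y~? T) ≤ l
    via-y≤ = common-neighbours-≤ (λ y≡v → v∉N[yY] (y , here refl , inj₁ y≡v))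
               (¬-not (λ y~v → v∉N[yY] (y , here refl , inj₂ y~v)))
               (Unique.filter⁺ y~? uT) (IndependentIn-filter G y~? ind) (All.tabulate via-y)

    via-Y≤ : length (filter (∁? y~?) T) ≤ length Y * l
    via-Y≤ = common-neighbours-of-list-≤ Y (λ (z , z∈Y , z~v) → v∉N[yY] (z , there z∈Y , z~v))
               (Unique.filter⁺ (∁? y~?) uT) (IndependentIn-filter G (∁? y~?) ind) (All.tabulate via-Y)

  open import Data.List.Membership.DecPropositional (Fin._≟_ {size G}) using (_∈?_)

  -- The neighbours of v outside W are common neighbours of v and vertices of Y, of which an
  -- independent set contains at most l per vertex of Y.
  IndepNbhdBound-extend : ∀ {L W Y v B} → v ∈ W → ¬ InClosedNbhd G Y v →
                          (∀ {s} → s ∈ L → Adj G v s → s ∉ W → InClosedNbhd G Y s) →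
                          IndepNbhdBound G W v B → IndepNbhdBound G L v (B * 2 ^ (length Y * l))
  IndepNbhdBound-extend {W = W} {Y} {v} {B} v∈W v∉N[Y] escapes bound S uS S⊆ ind = begin
    2 ^ length S                              ≡⟨ cong (2 ^_) (length-filter-∁ (_∈? W) S) ⟨
    2 ^ (length inside + length outside)      ≡⟨ ^-distribˡ-+-* 2 (length inside) (length outside) ⟩
    2 ^ length inside * 2 ^ length outside    ≤⟨ *-mono-≤ inside-bound (^-monoʳ-≤ 2 outside-bound) ⟩
    B * 2 ^ (length Y * l)                    ∎
    where
    open ≤-Reasoning
    inside  = filter (_∈? W) S
    outside = filter (∁? (_∈? W)) S

    inside⊆ : ∀ {s} → s ∈ inside → s ∈ W × InClosedNbhdOf G v s
    inside⊆ s∈ with ∈-filter⁻ (_∈? W) s∈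
    ... | s∈S , s∈W = s∈W , proj₂ (All.lookup S⊆ s∈S)

    outside-common : ∀ {s} → s ∈ outside → Adj G v s × ∃ λ y → y ∈ Y × Adj G y s
    outside-common s∈ with ∈-filter⁻ (∁? (_∈? W)) s∈
    ... | s∈S , s∉W with All.lookup S⊆ s∈S
    ... | _   , inj₁ refl = ⊥-elim (s∉W v∈W)
    ... | s∈L , inj₂ v~s with escapes s∈L v~s s∉W
    ... | y , y∈Y , inj₁ refl = ⊥-elim (v∉N[Y] (y , y∈Y , inj₂ (trans (Graph.sym G y v) v~s)))
    ... | y , y∈Y , inj₂ y~s  = v~s , y , y∈Y , y~s

    inside-bound : 2 ^ length inside ≤ B
    inside-bound = bound inside (Unique.filter⁺ (_∈? W) uS) (All.tabulate inside⊆) (IndependentIn-filter G (_∈? W) ind)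

    outside-bound : length outside ≤ length Y * l
    outside-bound = common-neighbours-of-list-≤ Y v∉N[Y] (Unique.filter⁺ (∁? (_∈? W)) uS)
                      (IndependentIn-filter G (∁? (_∈? W)) ind) (All.tabulate outside-common)

module _ (d : ℕ) (2≤d : 2 ≤ d) (𝒢 : GraphClass) (hereditary : Hereditary 𝒢)
         (separators : HasDominatedBalancedSeparators d 𝒢)
         (l : ℕ) (G : Graph) (G∈𝒢 : 𝒢 G) (free : K2ℓFree (suc l) G) where

  budget : ℕ → ℕ
  budget n = 2 * n ^ (d * l)

  budget-mono : ∀ {m n} → m ≤ n → budget m ≤ budget n
  budget-mono m≤n = *-monoʳ-≤ 2 (^-monoˡ-≤ (d * l) m≤n)

  2≤budget : ∀ {n} → 1 ≤ n → 2 ≤ budget n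
  2≤budget {n} 1≤n = *-monoʳ-≤ 2 (m^n>0 n {{>-nonZero 1≤n}} (d * l))

  budget-scale : ∀ c {m n e} → c * m ^ d ≤ n ^ d → e ≤ c ^ l → budget m * e ≤ budget n
  budget-scale c {m} {n} {e} cmᵈ≤nᵈ e≤cˡ = begin
    2 * m ^ (d * l) * e          ≡⟨ *-assoc 2 (m ^ (d * l)) e ⟩
    2 * (m ^ (d * l) * e)        ≤⟨ *-monoʳ-≤ 2 (*-monoʳ-≤ (m ^ (d * l)) e≤cˡ) ⟩
    2 * (m ^ (d * l) * c ^ l)    ≤⟨ *-monoʳ-≤ 2 (pow-scale c m n d l cmᵈ≤nᵈ) ⟩
    2 * n ^ (d * l)              ∎
    where open ≤-Reasoning

  GoodVertexOf : List (V G) → Set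
  GoodVertexOf L = ∃ λ v → v ∈ L × IndepNbhdBound G L v (budget (length L))

  InductionHypothesis : List (V G) → Set
  InductionHypothesis L = ∀ {W} → length W < length L → Unique W → 1 ≤ length W → GoodVertexOf W

  separated-case : ∀ {L X} → InductionHypothesis L → length X ≤ d → SmallComponent G L X → GoodVertexOf L
  separated-case {L} {X} ih |X|≤d C =
    let (v , v∈W , bound) = ih (2*m≤n⇒m<n nonempty small) unique nonempty
    in v , All.lookup ⊆L v∈W ,
       IndepNbhdBound-mono G (budget-scale (2 ^ d) halved growth)
         (IndepNbhdBound-extend G free v∈W (All.lookup avoids v∈W) (escapes v∈W) bound)
    where
    open SmallComponent C
    escapes : ∀ {v s} → v ∈ part → s ∈ L → Adj G v s → s ∉ part → InClosedNbhd G X s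
    escapes v∈W s∈L v~s s∉W = [ ⊥-elim ∘ s∉W , id ]′ (closed v∈W s∈L v~s)

    halved : 2 ^ d * length part ^ d ≤ length L ^ d
    halved = ≤-trans (≤-reflexive (sym (^-distribʳ-* 2 (length part) d))) (^-monoˡ-≤ d small)

    growth : 2 ^ (length X * l) ≤ (2 ^ d) ^ l
    growth = ≤-trans (^-monoʳ-≤ 2 (*-monoˡ-≤ l |X|≤d)) (≤-reflexive (sym (^-*-assoc 2 d l)))

  good-vertex-for-sublist : ∀ {L R x} → InductionHypothesis L → x ∈ L → Unique R → length R < length L →
                            All (_∈ L) R → ∃ λ v → v ∈ L × IndepNbhdBound G R v (budget (length L))
  good-vertex-for-sublist {R = []} {x} _ x∈L _ _ _ =
    x , x∈L , IndepNbhdBound-mono G (≤-trans (n≤1+n 1) (2≤budget (∈-length x∈L))) (IndepNbhdBound-[] G)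
  good-vertex-for-sublist {R = R@(_ ∷ _)} ih _ uR R<L R⊆L =
    let (v , v∈R , bound) = ih R<L uR (s≤s z≤n)
    in v , All.lookup R⊆L v∈R , IndepNbhdBound-mono G (budget-mono (<⇒≤ R<L)) bound

  universal-case : ∀ {L x} → Unique L → InductionHypothesis L → x ∈ L → All (InClosedNbhdOf G x) L →
                   GoodVertexOf L
  universal-case {L} {x} uL ih x∈L universal =
    let (v , v∈L , bound) = good-vertex-for-sublist ih x∈L (Unique.filter⁺ ≢x? uL)
                              (filter-notAll ≢x? L (Any.map (λ x≡y x≢y → x≢y x≡y) x∈L))
                              (All.tabulate (proj₁ ∘ ∈-filter⁻ ≢x?))
    in v , v∈L , IndepNbhdBound-universal G universal (2≤budget (∈-length x∈L)) bound
    where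
    ≢x? = ∁? (x Fin.≟_)

  nonuniversal-case : ∀ {L x} → Unique L → InductionHypothesis L → x ∈ L →
                      length L ≤ d * length (filter (InClosedNbhdOf? G x) L) →
                      ¬ All (InClosedNbhdOf G x) L → GoodVertexOf L
  nonuniversal-case {L} {x} uL ih x∈L heavy ¬universal =
    let (v , v∈W , bound) = ih |W|<|L| (Unique.filter⁺ far? uL) nonempty
        (v∈L , v∉N[x]) = ∈-filter⁻ far? v∈W
    in v , v∈L ,
       IndepNbhdBound-mono G (budget-scale 2 (pow-shrink d (length W) (length L) 2≤d shrunk)
                                             (≤-reflexive (cong (2 ^_) (*-identityˡ l))))
         (IndepNbhdBound-extend G free v∈W (λ { (_ , here refl , x~v) → v∉N[x] x~v }) escapes bound)
    where
    far? = ∁? (InClosedNbhdOf? G x)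
    W = filter far? L
    near = length (filter (InClosedNbhdOf? G x) L)

    nonempty : 1 ≤ length W
    nonempty = let (y , y∈L , y-far) = find (¬All⇒Any¬ (InClosedNbhdOf? G x) L ¬universal)
               in ∈-length (∈-filter⁺ far? y∈L y-far)

    shrunk : d * length W + length L ≤ d * length L
    shrunk = begin
      d * length W + length L   ≤⟨ +-monoʳ-≤ (d * length W) heavy ⟩
      d * length W + d * near   ≡⟨ *-distribˡ-+ d (length W) near ⟨
      d * (length W + near)     ≡⟨ cong (d *_) (trans (+-comm (length W) near) (length-filter-∁ (InClosedNbhdOf? G x) L)) ⟩
      d * length L              ∎
      where open ≤-Reasoning

    |W|<|L| : length W < length L
    |W|<|L| = *-cancelˡ-< d (length W) (length L) (<-≤-trans (m<m+n (d * length W) (∈-length x∈L)) shrunk)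

    escapes : ∀ {v s} → s ∈ L → Adj G v s → s ∉ W → InClosedNbhd G (x ∷ []) s
    escapes {s = s} s∈L _ s∉W with InClosedNbhdOf? G x s
    ... | yes x~s = x , here refl , x~s
    ... | no  x≁s = ⊥-elim (s∉W (∈-filter⁺ far? s∈L x≁s))

  dominated-case : ∀ {L x} → Unique L → InductionHypothesis L → x ∈ L →
                   length L ≤ d * length (filter (InClosedNbhdOf? G x) L) → GoodVertexOf L
  dominated-case {L} {x} uL ih x∈L heavy with All.all? (InClosedNbhdOf? G x) L
  ... | yes universal = universal-case uL ih x∈L universal
  ... | no ¬universal = nonuniversal-case uL ih x∈L heavy ¬universal

  good-vertex-step : ∀ {L} → Unique L → 1 ≤ length L → InductionHypothesis L → GoodVertexOf L
  good-vertex-step {L} uL 1≤|L| ih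
    with separators (induced G L) (hereditary G (induced G L) (induced-≼ G uL) G∈𝒢)
  ... | X , |X|≤d , balanced
    with |X|′≤d ← subst (_≤ d) (sym (length-map (lookup L) X)) |X|≤d
       | any? (λ i → ¬? (InClosedNbhd? (induced G L) X i))
  ... | yes (u , u∉N[X]) = separated-case ih |X|′≤d (small-component G uL balanced u u∉N[X])
  ... | no  ¬separated =
    let (x , x∈X , heavy) = heaviest-cover (InClosedNbhdOf? G) (map (lookup L) X) L
                              (N[X]-induced-cover G L dominated) 1≤|L|
    in dominated-case uL ih (map-lookup-⊆ G L x∈X) (≤-trans heavy (*-monoˡ-≤ _ |X|′≤d))
    where
    dominated : ∀ i → InClosedNbhd (induced G L) X i
    dominated i = decidable-stable (InClosedNbhd? (induced G L) X i) (λ i∉N[X] → ¬separated (i , i∉N[X]))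

  good-vertex : ∀ L → Unique L → 1 ≤ length L → GoodVertexOf L
  good-vertex = WF.All.wfRec (wellFounded length <-wellFounded) 0ℓ
                  (λ L → Unique L → 1 ≤ length L → GoodVertexOf L)
                  (λ L rec uL 1≤|L| → good-vertex-step uL 1≤|L| (λ lt uW 1≤|W| → rec lt uW 1≤|W|))

theorem1p9 : (d : ℕ) → 2 ≤ d → (𝒢 : GraphClass) → Hereditary 𝒢 →
    HasDominatedBalancedSeparators d 𝒢 →
    (ℓ : ℕ) → 2 ≤ ℓ → (G : Graph) → 𝒢 G → K2ℓFree ℓ G → 2 ≤ size G →
    ∃ λ (v : V G) → AlphaNbhdBound G v d ℓ
theorem1p9 d 2≤d 𝒢 hereditary separators (suc l) _ G G∈𝒢 free 2≤n =
  let (v , _ , bound) = good-vertex d 2≤d 𝒢 hereditary separators l G G∈𝒢 free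
                          (allFin n) (Unique.allFin⁺ n) (subst (1 ≤_) (sym |V|≡n) (≤-trans (n≤1+n 1) 2≤n))
  in v , λ S uS S⊆N[v] ind → ≤-trans (bound S uS (All.map (∈-allFin _ ,_) S⊆N[v]) ind) budget≤
  where
  n = size G
  |V|≡n : length (allFin n) ≡ n
  |V|≡n = length-tabulate id
  budget≤ : 2 * length (allFin n) ^ (d * l) ≤ n ^ (d * suc l)
  budget≤ = subst (λ m → 2 * m ^ (d * l) ≤ n ^ (d * suc l)) (sym |V|≡n)
                  (2*n^[d*l]≤n^[d*[1+l]] d l n (≤-trans (n≤1+n 1) 2≤d) 2≤n)
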